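{- Let $X_1,\ldots,X_n$ be connected graphs, $X_i=(\Omega_i,E_i)$, that are pairwise $\mathrm{WL}$-equivalent, and let $X=X_1\,\square\cdots\square\,X_n$. Let $\varphi_{ij}:\mathrm{WL}(X_i)\to\mathrm{WL}(X_j)$, $1\le i,j\le n$, be algebraic isomorphisms with $\varphi_{ij}(E_i)=E_j$, $\varphi_{ii}=\mathrm{id}$ and $\varphi_{ij}\varphi_{jk}=\varphi_{ik}$ for all $i,j,k$. Then $$\{\mathrm{WL}(X_1),\ldots,\mathrm{WL}(X_n)\}\uparrow\mathrm{Sym}(n)\ \ge\ \mathrm{WL}(X),$$ where the exponentiation is formed with respect to the family $\varphi_{ij}$.
   Context: Graphs are finite simple undirected. The Cartesian product $X_1\,\square\cdots\square\,X_n$ has vertex set $\Omega_1\times\cdots\times\Omega_n$, two vertices adjacent iff they differ in exactly one coordinate $i$ and their $i$-th coordinates are adjacent in $X_i$. A coherent configuration on a finite set $\Omega$ is $(\Omega,S)$ with $S$ a partition of $\Omega^2$ (basis relations) such that $1_\Omega$ is a union of basis relations, $S$ is closed under transposition, and for $r,s,t\in S$ the number $c^t_{r,s}=|\{\gamma:(\alpha,\gamma)\in r,(\gamma,\beta)\in s\}|$ is constant over $(\alpha,\beta)\in t$. Relations are unions of basis relations. An algebraic isomorphism is a bijection of basis relations preserving all $c^t_{r,s}$, extended to unions. $\mathcal X\le\mathcal X'$ (same set) means each basis relation of $\mathcal X$ is a union of basis relations of $\mathcal X'$. $\mathrm{WL}(X)$ is the smallest coherent configuration on the vertex set having the edge set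 as a relation. Graphs $X_i,X_j$ are $\mathrm{WL}$-equivalent if there is an algebraic isomorphism $\mathrm{WL}(X_i)\to\mathrm{WL}(X_j)$ mapping $E_i$ to $E_j$. Composition $\varphi_{ij}\varphi_{jk}$ means apply $\varphi_{ij}$ first. The tensor product $\mathrm{WL}(X_1)\otimes\cdots\otimes\mathrm{WL}(X_n)$ has basis relations $s_1\otimes\cdots\otimes s_n=\{(\alpha,\beta):(\alpha_i,\beta_i)\in s_i\ \forall i\}$. For $g\in\mathrm{Sym}(n)$ define $\varphi_g$ on these basis relations by $(s_1\otimes\cdots\otimes s_n)^{\varphi_g}=\varphi_{j_11}(s_{j_1})\otimes\cdots\otimes\varphi_{j_nn}(s_{j_n})$, $j_i=i^{g^{ -1}}$. The exponentiation $\{\mathrm{WL}(X_i)\}_{i=1}^n\uparrow\mathrm{Sym}(n)$ is the coherent configuration on $\Omega_1\times\cdots\times\Omega_n$ whose basis relations are the sets $\bigcup_{g\in\mathrm{Sym}(n)}(s_1\otimes\cdots\otimes s_n)^{\varphi_g}$. -}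

module Defs where

open import Data.Nat using (ℕ; zero; suc; _+_)
open import Data.Fin using (Fin; zero; suc; _≟_)
open import Data.Fin.Permutation using (Permutation′; _⟨$⟩ˡ_)
open import Data.Bool using (Bool; true; false; if_then_else_; _∧_)
open import Data.Unit using (⊤; tt)
open import Data.Product using (Σ; ∃; _×_; _,_)
open import Function using (_∘_; Bijective)
open import Relation.Nullary using (¬_)
open import Relation.Nullary.Decidable using (⌊_⌋)
open import Relation.Binary.PropositionalEquality using (_≡_)

sumFin : (m : ℕ) → (Fin m → ℕ) → ℕ
sumFin zero    f = 0
sumFin (suc m) f = f zero + sumFin m (f ∘ suc)

countFin : (m : ℕ) → (Fin m → Bool) → ℕ
countFin m P = sumFin m (λ a → if P a then 1 else 0)

Tup : (n : ℕ) → (Fin n → ℕ) → Set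
Tup zero    m = ⊤
Tup (suc n) m = Fin (m zero) × Tup n (m ∘ suc)

coord : ∀ {n} {m : Fin n → ℕ} → Tup n m → (i : Fin n) → Fin (m i)
coord {suc n} (a , t) zero    = a
coord {suc n} (a , t) (suc i) = coord t i

countTup : (n : ℕ) (m : Fin n → ℕ) → (Tup n m → Bool) → ℕ
countTup zero    m P = if P tt then 1 else 0
countTup (suc n) m P = sumFin (m zero) (λ a → countTup n (m ∘ suc) (λ t → P (a , t)))

-- Coherent configurations on a finite set Ω (with counting function cnt),
-- given by a colouring c : Ω → Ω → Fin k; the basis relations are the
-- (nonempty) colour classes  {(α,β) : c α β ≡ s}.

module CC {Ω : Set} (cnt : (Ω → Bool) → ℕ) where

  inum : ∀ {k} → (Ω → Ω → Fin k) → Fin k → Fin k → Ω → Ω → ℕ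
  inum c r s α β = cnt (λ γ → ⌊ c α γ ≟ r ⌋ ∧ ⌊ c γ β ≟ s ⌋)

  record IsCC {k : ℕ} (c : Ω → Ω → Fin k) : Set where
    field
      nonempty : ∀ s → ∃ λ α → ∃ λ β → c α β ≡ s
      -- 1_Ω is a union of basis relations
      diagonal : ∀ α β γ → c α α ≡ c β γ → β ≡ γ
      transpose : ∀ α β γ δ → c α β ≡ c γ δ → c β α ≡ c δ γ
      intersection : ∀ r s α β α′ β′ → c α β ≡ c α′ β′ →
                     inum c r s α β ≡ inum c r s α′ β′

  IsRelation : ∀ {k} → (Ω → Ω → Fin k) → (Ω → Ω → Set) → Set
  IsRelation c R = ∀ α β γ δ → c α β ≡ c γ δ → R α β → R γ δ

  -- c ≤ c′ : each basis relation of c is a union of basis relations of c′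
  _≤CC_ : ∀ {k k′} → (Ω → Ω → Fin k) → (Ω → Ω → Fin k′) → Set
  c ≤CC c′ = ∀ α β γ δ → c′ α β ≡ c′ γ δ → c α β ≡ c γ δ

  record IsWL (E : Ω → Ω → Set) {k : ℕ} (c : Ω → Ω → Fin k) : Set₁ where
    field
      coherent : IsCC c
      hasEdges : IsRelation c E
      smallest : ∀ (k′ : ℕ) (c′ : Ω → Ω → Fin k′) →
                 IsCC c′ → IsRelation c′ E → c ≤CC c′

record Graph (m : ℕ) : Set where
  field
    adj       : Fin m → Fin m → Bool
    symmetric : ∀ α β → adj α β ≡ adj β α
    loopless  : ∀ α → adj α α ≡ false

Edge : ∀ {m} → Graph m → Fin m → Fin m → Set
Edge G α β = Graph.adj G α β ≡ true

data Walk {m} (G : Graph m) : Fin m → Fin m → Set where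
  here : ∀ {α} → Walk G α α
  step : ∀ {α β γ} → Edge G α β → Walk G β γ → Walk G α γ

Connected : ∀ {m} → Graph m → Set
Connected G = ∀ α β → Walk G α β

ProdEdge : ∀ {n} {m : Fin n → ℕ} → ((i : Fin n) → Graph (m i)) →
           Tup n m → Tup n m → Set
ProdEdge G α β =
  Σ _ λ i → Edge (G i) (coord α i) (coord β i) × (∀ j → ¬ (j ≡ i) → coord α j ≡ coord β j)

record IsAlgIso {m₁ m₂ k₁ k₂ : ℕ}
                (c₁ : Fin m₁ → Fin m₁ → Fin k₁) (c₂ : Fin m₂ → Fin m₂ → Fin k₂)
                (φ : Fin k₁ → Fin k₂) : Set where
  field
    bijective : Bijective _≡_ _≡_ φ
    preserves : ∀ r s α β α′ β′ → φ (c₁ α β) ≡ c₂ α′ β′ →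
                CC.inum (countFin m₁) c₁ r s α β ≡ CC.inum (countFin m₂) c₂ (φ r) (φ s) α′ β′

-- φ(E₁) = E₂ (φ extended to unions of basis relations)
MapsEdges : ∀ {m₁ m₂ k₁ k₂} → Graph m₁ → Graph m₂ →
            (Fin m₁ → Fin m₁ → Fin k₁) → (Fin m₂ → Fin m₂ → Fin k₂) →
            (Fin k₁ → Fin k₂) → Set
MapsEdges G₁ G₂ c₁ c₂ φ =
  ∀ α β α′ β′ → φ (c₁ α β) ≡ c₂ α′ β′ → Graph.adj G₁ α β ≡ Graph.adj G₂ α′ β′

-- Exponentiation {WL(Xᵢ)} ↑ Sym(n) w.r.t. φ :
-- (α,β) and (γ,δ) lie in the same basis relation iff (γ,δ) ∈ (s₁⊗⋯⊗sₙ)^{φ_g}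
-- for some g ∈ Sym(n), where sᵢ = cᵢ(αᵢ,βᵢ), and jᵢ = i^{g⁻¹}.

SameExpClass : ∀ {n} {m k : Fin n → ℕ} →
               (c : (i : Fin n) → Fin (m i) → Fin (m i) → Fin (k i)) →
               (φ : (i j : Fin n) → Fin (k i) → Fin (k j)) →
               Tup n m → Tup n m → Tup n m → Tup n m → Set
SameExpClass {n} c φ α β γ δ =
  Σ (Permutation′ n) λ g → ∀ i →
    let j = g ⟨$⟩ˡ i in
    c i (coord γ i) (coord δ i) ≡ φ j i (c j (coord α j) (coord β j))

ExpGeq : ∀ {n} {m k : Fin n → ℕ} →
         (c : (i : Fin n) → Fin (m i) → Fin (m i) → Fin (k i)) →
         (φ : (i j : Fin n) → Fin (k i) → Fin (k j)) →
         ∀ {K} → (Tup n m → Tup n m → Fin K) → Set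
ExpGeq c φ cX = ∀ α β γ δ → SameExpClass c φ α β γ δ → cX α β ≡ cX γ δ

{-# OPTIONS --safe #-}
module Submission where

-- Let t(α, β) be the multiset of the colours φᵢ₀(cᵢ(αᵢ, βᵢ)), all transported into WL(X₀).
-- Two pairs in one basis relation of the exponentiation have the same t, so it suffices that
-- "same t" is a coherent configuration having the edges of X as a relation: minimality of WL(X)
-- does the rest. Reflexivity and transposition are read off coordinatewise, since algebraic
-- isomorphisms respect both. The number of γ with t(α, γ) = r and t(γ, β) = s is a sum over pairs
-- of colour words a, b of ∏ᵢ p^{tᵢ}_{aᵢ bᵢ}, computed in WL(X₀); this is symmetric in the tᵢ,
-- hence a function of the multiset t(α, β). Finally, (α, β) is an edge of X iff t(α, β) is one
-- edge colour plus reflexive colours.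

open import Defs
open import Data.Nat using (ℕ; zero; suc; _+_; _*_)
open import Data.Nat.Properties using (+-*-semiring; *-commutativeSemigroup; +-identityʳ; m+n≡0⇒n≡0)
open import Data.Fin using (Fin; zero; suc; _≟_; punchIn; punchOut)
open import Data.Fin.Properties using (≤-decTotalOrder; ≤-totalOrder; punchInᵢ≢i; punchIn-punchOut)
open import Data.Fin.Permutation using (Permutation′; _⟨$⟩ʳ_; _⟨$⟩ˡ_)
import Data.Fin.Permutation as Perm
open import Data.Vec.Functional using (removeAt)
open import Data.Bool using (Bool; true; false; if_then_else_; _∧_; T)
open import Data.Bool.Properties using (T-∧)
open import Data.Unit using (tt)
open import Data.Product using (∃; ∃₂; _×_; _,_; proj₁; proj₂; uncurry)
import Data.Product as Product
open import Data.List
  using (List; []; _∷_; tabulate; map; length; lookup; deduplicate; allFin; cartesianProduct)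
open import Data.List.Properties using (tabulate-cong; map-tabulate; ≡-dec)
import Data.List.Sort as Sort
open import Data.List.Membership.Propositional using (_∈_)
open import Data.List.Membership.Propositional.Properties
  using ( ∈-tabulate⁻; ∈-lookup; ∈-allFin; ∈-cartesianProduct⁺; ∈-map⁺; ∈-map⁻
        ; ∈-deduplicate⁺; ∈-deduplicate⁻)
open import Data.List.Relation.Unary.Any using (here; there)
import Data.List.Relation.Unary.Any as Any
open import Data.List.Relation.Unary.Any.Properties using (lookup-index)
open import Data.List.Relation.Unary.All using (All)
import Data.List.Relation.Unary.All as All
import Data.List.Relation.Unary.All.Properties as All
open import Data.List.Relation.Unary.AllPairs using (_∷_)
open import Data.List.Relation.Unary.Unique.Propositional using (Unique)
open import Data.List.Relation.Unary.Unique.DecPropositional.Properties using (deduplicate-!)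
open import Data.List.Relation.Unary.Sorted.TotalOrder.Properties using (↗↭↗⇒≋)
open import Data.List.Relation.Binary.Pointwise using (Pointwise; []; _∷_; Pointwise-≡⇒≡)
import Data.List.Relation.Binary.Pointwise as Pointwise
open import Data.List.Relation.Binary.Permutation.Propositional
  using (_↭_; ↭-refl; ↭-sym; ↭-trans; ↭⇒↭ₛ; module PermutationReasoning)
import Data.List.Relation.Binary.Permutation.Propositional as ↭
open import Data.List.Relation.Binary.Permutation.Propositional.Properties
  using (∈-resp-↭; All-resp-↭; map⁺; drop-∷)
open import Function using (_∘_; id; flip; Equivalence; _⇔_; mk⇔)
open import Relation.Nullary using (Dec; contradiction)
open import Relation.Nullary.Decidable using (⌊_⌋; toWitness; fromWitness; ⌊⌋-map′; does-⇔; isYes≗does)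
open import Relation.Binary.Definitions using (DecidableEquality)
open import Relation.Binary.PropositionalEquality
open import Algebra.Properties.CommutativeSemigroup *-commutativeSemigroup using (x∙yz≈y∙xz)
open import Algebra.Properties.Semiring.Sum +-*-semiring
  using (sum; sum-cong-≗; ∑-comm; *-distribˡ-sum; *-distribʳ-sum; sum-replicate-zero)

χ : Bool → ℕ
χ b = if b then 1 else 0

sumFin-cong : ∀ m {f g : Fin m → ℕ} → (∀ i → f i ≡ g i) → sumFin m f ≡ sumFin m g
sumFin-cong zero    f≗g = refl
sumFin-cong (suc m) f≗g = cong₂ _+_ (f≗g zero) (sumFin-cong m (f≗g ∘ suc))

sumFin≡sum : ∀ m (f : Fin m → ℕ) → sumFin m f ≡ sum f
sumFin≡sum zero    f = refl
sumFin≡sum (suc m) f = cong (f zero +_) (sumFin≡sum m (f ∘ suc))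

module _ {K : ℕ} where

  ∑² : (Fin K → Fin K → ℕ) → ℕ
  ∑² f = sum (λ a → sum (λ b → f a b))

  ∑²-cong : ∀ {f g : Fin K → Fin K → ℕ} → (∀ a b → f a b ≡ g a b) → ∑² f ≡ ∑² g
  ∑²-cong f≗g = sum-cong-≗ (λ a → sum-cong-≗ (f≗g a))

  ∑²-*ˡ : ∀ x (f : Fin K → Fin K → ℕ) → ∑² (λ a b → x * f a b) ≡ x * ∑² f
  ∑²-*ˡ x f = begin
    ∑² (λ a b → x * f a b)          ≡⟨ sum-cong-≗ (λ a → sym (*-distribˡ-sum x (f a))) ⟩
    sum (λ a → x * sum (f a))       ≡⟨ sym (*-distribˡ-sum x (λ a → sum (f a))) ⟩
    x * ∑² f                        ∎
    where open ≡-Reasoning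

  ∑²-comm : ∀ (F : Fin K → Fin K → Fin K → Fin K → ℕ) →
            ∑² (λ a b → ∑² (λ a′ b′ → F a b a′ b′)) ≡ ∑² (λ a′ b′ → ∑² (λ a b → F a b a′ b′))
  ∑²-comm F = begin
    sum (λ a → sum (λ b → sum (λ a′ → sum (λ b′ → F a b a′ b′))))
      ≡⟨ sum-cong-≗ (λ a → ∑-comm (λ b a′ → sum (λ b′ → F a b a′ b′))) ⟩
    sum (λ a → sum (λ a′ → sum (λ b → sum (λ b′ → F a b a′ b′))))
      ≡⟨ ∑-comm (λ a a′ → sum (λ b → sum (λ b′ → F a b a′ b′))) ⟩
    sum (λ a′ → sum (λ a → sum (λ b → sum (λ b′ → F a b a′ b′))))
      ≡⟨ sum-cong-≗ (λ a′ → sum-cong-≗ (λ a → ∑-comm (λ b b′ → F a b a′ b′))) ⟩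
    sum (λ a′ → sum (λ a → sum (λ b′ → sum (λ b → F a b a′ b′))))
      ≡⟨ sum-cong-≗ (λ a′ → ∑-comm (λ a b′ → sum (λ b → F a b a′ b′))) ⟩
    sum (λ a′ → sum (λ b′ → sum (λ a → sum (λ b → F a b a′ b′)))) ∎
    where open ≡-Reasoning

  ∑²-interchange : ∀ (x y : Fin K → Fin K → ℕ) (F : Fin K → Fin K → Fin K → Fin K → ℕ) →
    ∑² (λ a b → x a b * ∑² (λ a′ b′ → y a′ b′ * F a b a′ b′)) ≡
    ∑² (λ a′ b′ → y a′ b′ * ∑² (λ a b → x a b * F a b a′ b′))
  ∑²-interchange x y F = begin
    ∑² (λ a b → x a b * ∑² (λ a′ b′ → y a′ b′ * F a b a′ b′))
      ≡⟨ ∑²-cong (λ a b → sym (∑²-*ˡ (x a b) _)) ⟩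
    ∑² (λ a b → ∑² (λ a′ b′ → x a b * (y a′ b′ * F a b a′ b′)))
      ≡⟨ ∑²-comm (λ a b a′ b′ → x a b * (y a′ b′ * F a b a′ b′)) ⟩
    ∑² (λ a′ b′ → ∑² (λ a b → x a b * (y a′ b′ * F a b a′ b′)))
      ≡⟨ ∑²-cong (λ a′ b′ → ∑²-cong (λ a b → x∙yz≈y∙xz (x a b) (y a′ b′) (F a b a′ b′))) ⟩
    ∑² (λ a′ b′ → ∑² (λ a b → y a′ b′ * (x a b * F a b a′ b′)))
      ≡⟨ ∑²-cong (λ a′ b′ → ∑²-*ˡ (y a′ b′) _) ⟩
    ∑² (λ a′ b′ → y a′ b′ * ∑² (λ a b → x a b * F a b a′ b′)) ∎
    where open ≡-Reasoning

sum-δ : ∀ {K} (y : Fin K) (h : Fin K → ℕ) → sum (λ a → χ ⌊ y ≟ a ⌋ * h a) ≡ h y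
sum-δ {suc K} zero    h = begin
  h zero + 0 + sum {K} (λ _ → 0) ≡⟨ cong₂ _+_ (+-identityʳ (h zero)) (sum-replicate-zero K) ⟩
  h zero + 0                     ≡⟨ +-identityʳ (h zero) ⟩
  h zero                         ∎
  where open ≡-Reasoning
sum-δ {suc K} (suc y) h = trans (sum-cong-≗ ≟-suc) (sum-δ y (h ∘ suc))
  where
  ≟-suc : ∀ a → χ ⌊ suc y ≟ suc a ⌋ * h (suc a) ≡ χ ⌊ y ≟ a ⌋ * h (suc a)
  ≟-suc a = cong (λ b → χ b * h (suc a)) (⌊⌋-map′ _ _ (y ≟ a))

χ-∧ : ∀ p q h → χ (p ∧ q) * h ≡ χ p * (χ q * h)
χ-∧ false q h = refl
χ-∧ true  q h = sym (+-identityʳ (χ q * h))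

∑²-δ : ∀ {K} (y z : Fin K) (H : Fin K → Fin K → ℕ) →
       ∑² (λ a b → χ (⌊ y ≟ a ⌋ ∧ ⌊ z ≟ b ⌋) * H a b) ≡ H y z
∑²-δ y z H = begin
  ∑² (λ a b → χ (⌊ y ≟ a ⌋ ∧ ⌊ z ≟ b ⌋) * H a b)
    ≡⟨ ∑²-cong (λ a b → χ-∧ ⌊ y ≟ a ⌋ ⌊ z ≟ b ⌋ (H a b)) ⟩
  ∑² (λ a b → χ ⌊ y ≟ a ⌋ * (χ ⌊ z ≟ b ⌋ * H a b))
    ≡⟨ sum-cong-≗ (λ a → sym (*-distribˡ-sum (χ ⌊ y ≟ a ⌋) (λ b → χ ⌊ z ≟ b ⌋ * H a b))) ⟩
  sum (λ a → χ ⌊ y ≟ a ⌋ * sum (λ b → χ ⌊ z ≟ b ⌋ * H a b))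
    ≡⟨ sum-cong-≗ (λ a → cong (χ ⌊ y ≟ a ⌋ *_) (sum-δ z (H a))) ⟩
  sum (λ a → χ ⌊ y ≟ a ⌋ * H a z)
    ≡⟨ sum-δ y (λ a → H a z) ⟩
  H y z ∎
  where open ≡-Reasoning

sumFin-fibres : ∀ M {K} (f g : Fin M → Fin K) (H : Fin K → Fin K → ℕ) →
                sumFin M (λ x → H (f x) (g x)) ≡
                ∑² (λ a b → countFin M (λ x → ⌊ f x ≟ a ⌋ ∧ ⌊ g x ≟ b ⌋) * H a b)
sumFin-fibres M f g H = begin
  sumFin M (λ x → H (f x) (g x))
    ≡⟨ sumFin≡sum M _ ⟩
  sum (λ x → H (f x) (g x))
    ≡⟨ sum-cong-≗ (λ x → sym (∑²-δ (f x) (g x) H)) ⟩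
  sum (λ x → ∑² (λ a b → I x a b * H a b))
    ≡⟨ ∑-comm (λ x a → sum (λ b → I x a b * H a b)) ⟩
  sum (λ a → sum (λ x → sum (λ b → I x a b * H a b)))
    ≡⟨ sum-cong-≗ (λ a → ∑-comm (λ x b → I x a b * H a b)) ⟩
  ∑² (λ a b → sum (λ x → I x a b * H a b))
    ≡⟨ ∑²-cong (λ a b → sym (*-distribʳ-sum (H a b) (λ x → I x a b))) ⟩
  ∑² (λ a b → sum (λ x → I x a b) * H a b)
    ≡⟨ ∑²-cong (λ a b → cong (_* H a b) (sym (sumFin≡sum M (λ x → I x a b)))) ⟩
  ∑² (λ a b → countFin M (λ x → ⌊ f x ≟ a ⌋ ∧ ⌊ g x ≟ b ⌋) * H a b) ∎
  where
  open ≡-Reasoning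
  I : Fin M → _ → _ → ℕ
  I x a b = χ (⌊ f x ≟ a ⌋ ∧ ⌊ g x ≟ b ⌋)

⌊⌋-⇔ : ∀ {A B : Set} → A ⇔ B → (a? : Dec A) (b? : Dec B) → ⌊ a? ⌋ ≡ ⌊ b? ⌋
⌊⌋-⇔ A⇔B a? b? = trans (isYes≗does a?) (trans (does-⇔ A⇔B a? b?) (sym (isYes≗does b?)))

T-≟∧≟⇔ : ∀ {k} {a b c d : Fin k} → T (⌊ a ≟ b ⌋ ∧ ⌊ c ≟ d ⌋) ⇔ (a ≡ b × c ≡ d)
T-≟∧≟⇔ {a = a} {b} {c} {d} = mk⇔
  (Product.map (toWitness {a? = a ≟ b}) (toWitness {a? = c ≟ d}) ∘ Equivalence.to (T-∧ {⌊ a ≟ b ⌋}))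
  (Equivalence.from (T-∧ {⌊ a ≟ b ⌋})
    ∘ Product.map (fromWitness {a? = a ≟ b}) (fromWitness {a? = c ≟ d}))

countFin≢0⇒∃ : ∀ m (P : Fin m → Bool) → countFin m P ≢ 0 → ∃ λ i → T (P i)
countFin≢0⇒∃ zero    P ≢0 = contradiction refl ≢0
countFin≢0⇒∃ (suc m) P ≢0 with P zero in P0
... | true  = zero , subst T (sym P0) _
... | false = Product.map suc id (countFin≢0⇒∃ m (P ∘ suc) ≢0)

∃⇒countFin≢0 : ∀ m (P : Fin m → Bool) i → T (P i) → countFin m P ≢ 0
∃⇒countFin≢0 (suc m) P zero    Pi with P zero
... | true = λ ()
∃⇒countFin≢0 (suc m) P (suc i) Pi = ∃⇒countFin≢0 m (P ∘ suc) i Pi ∘ m+n≡0⇒n≡0 (χ (P zero))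

module _ {m k : ℕ} (c : Fin m → Fin m → Fin k) where

  inum≢0⇒∃ : ∀ r s α β → CC.inum (countFin m) c r s α β ≢ 0 →
             ∃ λ γ → c α γ ≡ r × c γ β ≡ s
  inum≢0⇒∃ r s α β ≢0 = Product.map₂ (Equivalence.to T-≟∧≟⇔) (countFin≢0⇒∃ m _ ≢0)

  ∃⇒inum≢0 : ∀ {r s α β} γ → c α γ ≡ r → c γ β ≡ s → CC.inum (countFin m) c r s α β ≢ 0
  ∃⇒inum≢0 γ αγ γβ = ∃⇒countFin≢0 m _ γ (Equivalence.from T-≟∧≟⇔ (αγ , γβ))

module AlgIso {m₁ m₂ k₁ k₂ : ℕ}
  {c₁ : Fin m₁ → Fin m₁ → Fin k₁} {c₂ : Fin m₂ → Fin m₂ → Fin k₂} {φ : Fin k₁ → Fin k₂}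
  (iso : IsAlgIso c₁ c₂ φ) where

  open IsAlgIso iso

  preimage : ∀ a → ∃ λ r → φ r ≡ a
  preimage a = Product.map₂ (λ φz≡a → φz≡a refl) (proj₂ bijective a)

  φ-inum : ∀ {x y a b} → φ (c₁ x y) ≡ c₂ a b → ∀ a′ b′ →
           countFin m₁ (λ z → ⌊ φ (c₁ x z) ≟ a′ ⌋ ∧ ⌊ φ (c₁ z y) ≟ b′ ⌋) ≡
           CC.inum (countFin m₂) c₂ a′ b′ a b
  φ-inum {x} {y} {a} {b} φxy a′ b′ = begin
    countFin m₁ (λ z → ⌊ φ (c₁ x z) ≟ a′ ⌋ ∧ ⌊ φ (c₁ z y) ≟ b′ ⌋)
      ≡⟨ sumFin-cong m₁ (λ z → cong₂ (λ p q → χ (p ∧ q)) (φ≟ r φr) (φ≟ s φs)) ⟩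
    CC.inum (countFin m₁) c₁ r s x y
      ≡⟨ preserves r s x y a b φxy ⟩
    CC.inum (countFin m₂) c₂ (φ r) (φ s) a b
      ≡⟨ cong₂ (λ p q → CC.inum (countFin m₂) c₂ p q a b) φr φs ⟩
    CC.inum (countFin m₂) c₂ a′ b′ a b ∎
    where
    open ≡-Reasoning
    r = proj₁ (preimage a′)
    φr = proj₂ (preimage a′)
    s = proj₁ (preimage b′)
    φs = proj₂ (preimage b′)
    φ≟ : ∀ {u v} t → φ t ≡ v → ⌊ φ u ≟ v ⌋ ≡ ⌊ u ≟ t ⌋
    φ≟ {u} {v} t φt = ⌊⌋-⇔ (mk⇔ (λ φu≡v → proj₁ bijective (trans φu≡v (sym φt)))
                                (λ u≡t → trans (cong φ u≡t) φt))
                           (φ u ≟ v) (u ≟ t)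

  module _ (cc₁ : CC.IsCC (countFin m₁) c₁) (cc₂ : CC.IsCC (countFin m₂) c₂) where

    -- The preimage s of c₂ b b has p^{c₁ x x}_{c₁ x x, s} ≠ 0 (witness b in c₂), which forces s = c₁ x x.
    φ-reflexive : ∀ {x a b} → φ (c₁ x x) ≡ c₂ a b → a ≡ b
    φ-reflexive {x} {a} {b} φxx = CC.IsCC.diagonal cc₂ b a b (trans (sym φxx≡bb) φxx)
      where
      s = proj₁ (preimage (c₂ b b))
      φs = proj₂ (preimage (c₂ b b))
      inum≢0 : CC.inum (countFin m₁) c₁ (c₁ x x) s x x ≢ 0
      inum≢0 = ∃⇒inum≢0 c₂ b (sym φxx) (sym φs) ∘ trans (sym (preserves (c₁ x x) s x x a b φxx))
      φxx≡bb : φ (c₁ x x) ≡ c₂ b b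
      φxx≡bb with γ , xγ , γx ← inum≢0⇒∃ c₁ _ _ x x inum≢0
             with refl ← CC.IsCC.diagonal cc₁ x x γ (sym xγ)
             = trans (cong φ γx) φs

    -- If (p, p) represents φ (c₁ x x), the witness y of p^{c₁ x x}_{c₁ x y, c₁ y x} ≠ 0 is carried
    -- over to some γ with c₂ p γ = c₂ a b and c₂ γ p = φ (c₁ y x).
    φ-transpose : ∀ {x y a b} → φ (c₁ x y) ≡ c₂ a b → φ (c₁ y x) ≡ c₂ b a
    φ-transpose {x} {y} {a} {b} φxy
      with p , q , pq ← CC.IsCC.nonempty cc₂ (φ (c₁ x x))
      with refl ← φ-reflexive (sym pq)
      with γ , pγ , γp ← inum≢0⇒∃ c₂ _ _ p p
             (∃⇒inum≢0 c₁ y refl refl ∘ trans (preserves (c₁ x y) (c₁ y x) x x p p (sym pq)))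
      = trans (sym γp) (CC.IsCC.transpose cc₂ p γ a b (trans pγ φxy))

module _ {K : ℕ} where

  PermutationInvariant : (List (Fin K) → Bool) → Set
  PermutationInvariant P = ∀ {l l′} → l ↭ l′ → P l ≡ P l′

  sumProd : (List (Fin K) → Bool) → (List (Fin K) → Bool) → List (Fin K → Fin K → ℕ) → ℕ
  sumProd P Q []       = χ (P [] ∧ Q [])
  sumProd P Q (w ∷ ws) = ∑² (λ a b → w a b * sumProd (P ∘ (a ∷_)) (Q ∘ (b ∷_)) ws)

  _≗²_ : (Fin K → Fin K → ℕ) → (Fin K → Fin K → ℕ) → Set
  w ≗² w′ = ∀ a b → w a b ≡ w′ a b

  sumProd-cong : ∀ {P P′ Q Q′ ws ws′} → (∀ l → P l ≡ P′ l) → (∀ l → Q l ≡ Q′ l) →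
                 Pointwise _≗²_ ws ws′ → sumProd P Q ws ≡ sumProd P′ Q′ ws′
  sumProd-cong P≗P′ Q≗Q′ []           = cong₂ (λ p q → χ (p ∧ q)) (P≗P′ []) (Q≗Q′ [])
  sumProd-cong P≗P′ Q≗Q′ (w≗w′ ∷ ws≗) = ∑²-cong (λ a b → cong₂ _*_ (w≗w′ a b)
    (sumProd-cong (P≗P′ ∘ (a ∷_)) (Q≗Q′ ∘ (b ∷_)) ws≗))

  sumProd-↭ : ∀ {P Q} → PermutationInvariant P → PermutationInvariant Q →
              ∀ {ws ws′} → ws ↭ ws′ → sumProd P Q ws ≡ sumProd P Q ws′
  sumProd-↭ P-inv Q-inv ↭.refl            = refl
  sumProd-↭ P-inv Q-inv (↭.trans p q)     = trans (sumProd-↭ P-inv Q-inv p) (sumProd-↭ P-inv Q-inv q)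
  sumProd-↭ P-inv Q-inv (↭.prep w p)      = ∑²-cong (λ a b → cong (w a b *_)
    (sumProd-↭ (P-inv ∘ ↭.prep a) (Q-inv ∘ ↭.prep b) p))
  sumProd-↭ {P} {Q} P-inv Q-inv (↭.swap {ws} {ws′} w w′ p) = begin
    ∑² (λ a b → w a b * ∑² (λ a′ b′ → w′ a′ b′ *
                                      sumProd (P ∘ (a ∷_) ∘ (a′ ∷_)) (Q ∘ (b ∷_) ∘ (b′ ∷_)) ws))
      ≡⟨ ∑²-cong (λ a b → cong (w a b *_)
           (∑²-cong (λ a′ b′ → cong (w′ a′ b′ *_) (swapped a b a′ b′)))) ⟩
    ∑² (λ a b → w a b * ∑² (λ a′ b′ → w′ a′ b′ * S a b a′ b′))
      ≡⟨ ∑²-interchange w w′ S ⟩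
    ∑² (λ a′ b′ → w′ a′ b′ * ∑² (λ a b → w a b * S a b a′ b′)) ∎
    where
    open ≡-Reasoning
    S : Fin K → Fin K → Fin K → Fin K → ℕ
    S a b a′ b′ = sumProd (P ∘ (a′ ∷_) ∘ (a ∷_)) (Q ∘ (b′ ∷_) ∘ (b ∷_)) ws′
    swapped : ∀ a b a′ b′ → sumProd (P ∘ (a ∷_) ∘ (a′ ∷_)) (Q ∘ (b ∷_) ∘ (b′ ∷_)) ws ≡ S a b a′ b′
    swapped a b a′ b′ = trans
      (sumProd-↭ (P-inv ∘ ↭.prep a ∘ ↭.prep a′) (Q-inv ∘ ↭.prep b ∘ ↭.prep b′) p)
      (sumProd-cong (λ l → P-inv (↭.swap a a′ (↭-refl {x = l})))
                    (λ l → Q-inv (↭.swap b b′ (↭-refl {x = l})))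
                    (Pointwise.refl (λ _ _ → refl) {ws′}))

allTup : ∀ n (m : Fin n → ℕ) → List (Tup n m)
allTup zero    m = tt ∷ []
allTup (suc n) m = cartesianProduct (allFin (m zero)) (allTup n (m ∘ suc))

∈-allTup : ∀ n (m : Fin n → ℕ) t → t ∈ allTup n m
∈-allTup zero    m tt      = here refl
∈-allTup (suc n) m (a , t) = ∈-cartesianProduct⁺ (∈-allFin a) (∈-allTup n (m ∘ suc) t)

coord-injective : ∀ n (m : Fin n → ℕ) {s t : Tup n m} → (∀ i → coord s i ≡ coord t i) → s ≡ t
coord-injective zero    m         _ = refl
coord-injective (suc n) m {a , s} {b , t} s≗t =
  cong₂ _,_ (s≗t zero) (coord-injective n (m ∘ suc) (s≗t ∘ suc))

countTup-cong : ∀ n (m : Fin n → ℕ) {P Q : Tup n m → Bool} → (∀ t → P t ≡ Q t) →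
                countTup n m P ≡ countTup n m Q
countTup-cong zero    m P≗Q = cong χ (P≗Q tt)
countTup-cong (suc n) m P≗Q = sumFin-cong (m zero) (λ a → countTup-cong n (m ∘ suc) (P≗Q ∘ (a ,_)))

countTup≡sumProd : ∀ n (m : Fin n → ℕ) {K} (f g : (i : Fin n) → Fin (m i) → Fin K)
                   (P Q : List (Fin K) → Bool) →
  countTup n m (λ γ → P (tabulate (λ i → f i (coord γ i))) ∧ Q (tabulate (λ i → g i (coord γ i)))) ≡
  sumProd P Q (tabulate (λ i a b → countFin (m i) (λ x → ⌊ f i x ≟ a ⌋ ∧ ⌊ g i x ≟ b ⌋)))
countTup≡sumProd zero    m f g P Q = refl
countTup≡sumProd (suc n) m f g P Q = trans
  (sumFin-cong (m zero) (λ x →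
    countTup≡sumProd n (m ∘ suc) (f ∘ suc) (g ∘ suc) (P ∘ (f zero x ∷_)) (Q ∘ (g zero x ∷_))))
  (sumFin-fibres (m zero) (f zero) (g zero) (λ a b →
    sumProd (P ∘ (a ∷_)) (Q ∘ (b ∷_))
            (tabulate (λ i a b → countFin (m (suc i))
                                   (λ x → ⌊ f (suc i) x ≟ a ⌋ ∧ ⌊ g (suc i) x ≟ b ⌋)))))

module _ {K : ℕ} where
  private module S = Sort (≤-decTotalOrder K)

  sort : List (Fin K) → List (Fin K)
  sort = S.sort

  sort-≡⇒↭ : ∀ {l l′} → sort l ≡ sort l′ → l ↭ l′
  sort-≡⇒↭ {l} {l′} e = ↭-trans (↭-sym (S.sort-↭ l)) (subst (_↭ l′) (sym e) (S.sort-↭ l′))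

  ↭⇒sort-≡ : ∀ {l l′} → l ↭ l′ → sort l ≡ sort l′
  ↭⇒sort-≡ {l} {l′} p = Pointwise-≡⇒≡ (↗↭↗⇒≋ (≤-totalOrder K) (S.sort-↗ l) (S.sort-↗ l′)
    (↭⇒↭ₛ (↭-trans (S.sort-↭ l) (↭-trans p (↭-sym (S.sort-↭ l′))))))

module _ {A : Set} where

  tabulate-removeAt : ∀ {n} (f : Fin (suc n) → A) i → tabulate f ↭ f i ∷ tabulate (removeAt f i)
  tabulate-removeAt         f zero    = ↭-refl
  tabulate-removeAt {suc n} f (suc i) =
    ↭-trans (↭.prep (f zero) (tabulate-removeAt (f ∘ suc) i)) (↭.swap (f zero) (f (suc i)) ↭-refl)

  tabulate-permute : ∀ {n} (f : Fin n → A) (π : Permutation′ n) → tabulate (f ∘ (π ⟨$⟩ʳ_)) ↭ tabulate f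
  tabulate-permute {zero}  f π = ↭-refl
  tabulate-permute {suc n} f π = begin
    tabulate (f ∘ (π ⟨$⟩ʳ_))
      ↭⟨ tabulate-removeAt (f ∘ (π ⟨$⟩ʳ_)) π₀ ⟩
    (f (π ⟨$⟩ʳ π₀) ∷ tabulate (removeAt (f ∘ (π ⟨$⟩ʳ_)) π₀))
      ≡⟨ cong₂ _∷_ (cong f (Perm.inverseʳ π)) (tabulate-cong (cong f ∘ Perm.punchIn-permute′ π zero)) ⟩
    (f zero ∷ tabulate (f ∘ suc ∘ (Perm.remove π₀ π ⟨$⟩ʳ_)))
      ↭⟨ ↭.prep (f zero) (tabulate-permute (f ∘ suc) (Perm.remove π₀ π)) ⟩
    (f zero ∷ tabulate (f ∘ suc)) ∎
    where
    open PermutationReasoning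
    π₀ = π ⟨$⟩ˡ zero

  tabulate-↭-∷⁻ : ∀ {n} (f : Fin (suc n) → A) {x xs} → tabulate f ↭ x ∷ xs →
                  ∃ λ i → f i ≡ x × tabulate (removeAt f i) ↭ xs
  tabulate-↭-∷⁻ f p with i , refl ← ∈-tabulate⁻ {f = f} (∈-resp-↭ (↭-sym p) (here refl)) =
    i , refl , drop-∷ (↭-trans (↭-sym (tabulate-removeAt f i)) p)

module _ {B : Set} where

  Unique⇒index-≡ : ∀ {x y : B} {ys} → Unique ys → x ≡ y → (p : x ∈ ys) (q : y ∈ ys) →
                   Any.index p ≡ Any.index q
  Unique⇒index-≡ _         _    (here _)     (here _)     = refl
  Unique⇒index-≡ (y∉ ∷ _)  refl (here refl)  (there q)    = contradiction refl (All.lookup y∉ q)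
  Unique⇒index-≡ (y∉ ∷ _)  refl (there p)    (here refl)  = contradiction refl (All.lookup y∉ p)
  Unique⇒index-≡ (_ ∷ ys!) x≡y  (there p)    (there q)    = cong suc (Unique⇒index-≡ ys! x≡y p q)

  index-∈-lookup : ∀ (ys : List B) i → Any.index (∈-lookup {xs = ys} i) ≡ i
  index-∈-lookup (y ∷ ys) zero    = refl
  index-∈-lookup (y ∷ ys) (suc i) = cong suc (index-∈-lookup ys i)

module FiniteImage {A B : Set} (_≟B_ : DecidableEquality B)
                   (xs : List A) (xs-complete : ∀ a → a ∈ xs) (f : A → B) where

  private
    image : List B
    image = deduplicate _≟B_ (map f xs)

    ∈-image : ∀ a → f a ∈ image
    ∈-image a = ∈-deduplicate⁺ _≟B_ (∈-map⁺ f (xs-complete a))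

  size : ℕ
  size = length image

  code : A → Fin size
  code a = Any.index (∈-image a)

  label : Fin size → B
  label = lookup image

  label-code : ∀ a → label (code a) ≡ f a
  label-code a = sym (lookup-index (∈-image a))

  code-label : ∀ a r → f a ≡ label r → code a ≡ r
  code-label a r fa≡r =
    trans (Unique⇒index-≡ (deduplicate-! _≟B_ (map f xs)) fa≡r (∈-image a) (∈-lookup r))
          (index-∈-lookup image r)

  code-surjective : ∀ r → ∃ λ a → code a ≡ r
  code-surjective r with a , _ , r≡fa ← ∈-map⁻ f (∈-deduplicate⁻ _≟B_ (map f xs) (∈-lookup r)) =
    a , code-label a r (sym r≡fa)

  code-≡⇔ : ∀ a b → code a ≡ code b ⇔ f a ≡ f b
  code-≡⇔ a b = mk⇔ (λ e → trans (sym (label-code a)) (trans (cong label e) (label-code b)))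
                    (λ e → code-label a (code b) (trans e (sym (label-code b))))

module Exponentiation
  {n : ℕ} {m k : Fin (suc n) → ℕ}
  (G : (i : Fin (suc n)) → Graph (m i))
  (c : (i : Fin (suc n)) → Fin (m i) → Fin (m i) → Fin (k i))
  (cc : (i : Fin (suc n)) → CC.IsCC (countFin (m i)) (c i))
  (φ : (i j : Fin (suc n)) → Fin (k i) → Fin (k j))
  (φiso : (i j : Fin (suc n)) → IsAlgIso (c i) (c j) (φ i j))
  (φE : (i j : Fin (suc n)) → MapsEdges (G i) (G j) (c i) (c j) (φ i j))
  (φid : (i : Fin (suc n)) (s : Fin (k i)) → φ i i s ≡ s)
  (φcomp : (i j l : Fin (suc n)) (s : Fin (k i)) → φ j l (φ i j s) ≡ φ i l s)
  where

  Ω : Set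
  Ω = Tup (suc n) m

  Colour : Set
  Colour = Fin (k zero)

  rep : Colour → Fin (m zero) × Fin (m zero)
  rep t = Product.map₂ proj₁ (CC.IsCC.nonempty (cc zero) t)

  rep-colour : ∀ t → uncurry (c zero) (rep t) ≡ t
  rep-colour t = proj₂ (proj₂ (CC.IsCC.nonempty (cc zero) t))

  Reflexive : Colour → Set
  Reflexive t = proj₁ (rep t) ≡ proj₂ (rep t)

  EdgeColour : Colour → Set
  EdgeColour t = uncurry (Edge (G zero)) (rep t)

  transposeColour : Colour → Colour
  transposeColour t = uncurry (flip (c zero)) (rep t)

  weight : Colour → Colour → Colour → ℕ
  weight t a b = uncurry (CC.inum (countFin (m zero)) (c zero) a b) (rep t)

  colourAt : (i : Fin (suc n)) → Fin (m i) → Fin (m i) → Colour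
  colourAt i x y = φ i zero (c i x y)

  colourAt-rep : ∀ i x y → colourAt i x y ≡ uncurry (c zero) (rep (colourAt i x y))
  colourAt-rep i x y = sym (rep-colour (colourAt i x y))

  reflexive⁺ : ∀ i {x y} → x ≡ y → Reflexive (colourAt i x y)
  reflexive⁺ i {x} refl = AlgIso.φ-reflexive (φiso i zero) (cc i) (cc zero) (colourAt-rep i x x)

  reflexive⁻ : ∀ i {x y} → Reflexive (colourAt i x y) → x ≡ y
  reflexive⁻ i {x} {y} r₁≡r₂ = AlgIso.φ-reflexive (φiso zero i) (cc zero) (cc i) back
    where
    open ≡-Reasoning
    t = colourAt i x y
    r₁ = proj₁ (rep t)
    back : φ zero i (c zero r₁ r₁) ≡ c i x y
    back = begin
      φ zero i (c zero r₁ r₁)             ≡⟨ cong (φ zero i ∘ c zero r₁) r₁≡r₂ ⟩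
      φ zero i (uncurry (c zero) (rep t)) ≡⟨ cong (φ zero i) (rep-colour t) ⟩
      φ zero i (φ i zero (c i x y))       ≡⟨ φcomp i zero i (c i x y) ⟩
      φ i i (c i x y)                     ≡⟨ φid i (c i x y) ⟩
      c i x y                             ∎

  adj-colourAt : ∀ i x y → uncurry (Graph.adj (G zero)) (rep (colourAt i x y)) ≡ Graph.adj (G i) x y
  adj-colourAt i x y = sym (φE i zero x y _ _ (colourAt-rep i x y))

  colourAt-transpose : ∀ i x y → colourAt i y x ≡ transposeColour (colourAt i x y)
  colourAt-transpose i x y = AlgIso.φ-transpose (φiso i zero) (cc i) (cc zero) (colourAt-rep i x y)

  colourAt-inum : ∀ i x y a b →
    countFin (m i) (λ z → ⌊ colourAt i x z ≟ a ⌋ ∧ ⌊ colourAt i z y ≟ b ⌋) ≡ weight (colourAt i x y) a b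
  colourAt-inum i x y = AlgIso.φ-inum (φiso i zero) (colourAt-rep i x y)

  colours : Ω → Ω → Fin (suc n) → Colour
  colours α β i = colourAt i (coord {m = m} α i) (coord {m = m} β i)

  profile : Ω → Ω → List Colour
  profile α β = tabulate (colours α β)

  -- A pair (α, β) is coloured by the sorted profile, as a canonical form of the multiset, coded
  -- surjectively into Fin because a coherent configuration may not have empty basis relations.
  module Code = FiniteImage (≡-dec _≟_) (cartesianProduct (allTup _ m) (allTup _ m))
    (λ (α , β) → ∈-cartesianProduct⁺ (∈-allTup _ m α) (∈-allTup _ m β))
    (λ (α , β) → sort (profile α β))

  expColour : Ω → Ω → Fin Code.size
  expColour α β = Code.code (α , β)

  expColour-≡⇔ : ∀ α β γ δ → expColour α β ≡ expColour γ δ ⇔ (profile α β ↭ profile γ δ)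
  expColour-≡⇔ α β γ δ = mk⇔ (sort-≡⇒↭ ∘ to) (from ∘ ↭⇒sort-≡)
    where open Equivalence (Code.code-≡⇔ (α , β) (γ , δ))

  InClass : Fin Code.size → List Colour → Bool
  InClass r l = ⌊ ≡-dec _≟_ (sort l) (Code.label r) ⌋

  InClass-↭ : ∀ r → PermutationInvariant (InClass r)
  InClass-↭ r l↭l′ = cong (λ l → ⌊ ≡-dec _≟_ l (Code.label r) ⌋) (↭⇒sort-≡ l↭l′)

  InClass-expColour : ∀ α β r → ⌊ expColour α β ≟ r ⌋ ≡ InClass r (profile α β)
  InClass-expColour α β r = ⌊⌋-⇔
    (mk⇔ (λ e → trans (sym (Code.label-code (α , β))) (cong Code.label e)) (Code.code-label (α , β) r))
    (expColour α β ≟ r) (≡-dec _≟_ (sort (profile α β)) (Code.label r))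

  inum-expColour : ∀ r s α β → CC.inum (countTup (suc n) m) expColour r s α β ≡
                   sumProd (InClass r) (InClass s) (map weight (profile α β))
  inum-expColour r s α β = begin
    countTup (suc n) m (λ γ → ⌊ expColour α γ ≟ r ⌋ ∧ ⌊ expColour γ β ≟ s ⌋)
      ≡⟨ countTup-cong (suc n) m (λ γ → cong₂ _∧_ (InClass-expColour α γ r) (InClass-expColour γ β s)) ⟩
    countTup (suc n) m (λ γ → InClass r (profile α γ) ∧ InClass s (profile γ β))
      ≡⟨ countTup≡sumProd (suc n) m (λ i → colourAt i (coord {m = m} α i))
                          (λ i z → colourAt i z (coord {m = m} β i)) (InClass r) (InClass s) ⟩
    sumProd (InClass r) (InClass s)
            (tabulate (λ i a b → countFin (m i) (λ z → ⌊ colourAt i (coord {m = m} α i) z ≟ a ⌋ ∧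
                                                       ⌊ colourAt i z (coord {m = m} β i) ≟ b ⌋)))
      ≡⟨ sumProd-cong {P = InClass r} {Q = InClass s} (λ _ → refl) (λ _ → refl)
                      (Pointwise.tabulate⁺ (λ i →
                         colourAt-inum i (coord {m = m} α i) (coord {m = m} β i))) ⟩
    sumProd (InClass r) (InClass s) (tabulate (weight ∘ colours α β))
      ≡⟨ cong (sumProd (InClass r) (InClass s)) (sym (map-tabulate (colours α β) weight)) ⟩
    sumProd (InClass r) (InClass s) (map weight (profile α β)) ∎
    where open ≡-Reasoning

  profile-transpose : ∀ α β → profile β α ≡ map transposeColour (profile α β)
  profile-transpose α β =
    trans (tabulate-cong (λ i → colourAt-transpose i (coord {m = m} α i) (coord {m = m} β i)))
          (sym (map-tabulate (colours α β) transposeColour))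

  All-Reflexive⇒≡ : ∀ α β → All Reflexive (profile α β) → α ≡ β
  All-Reflexive⇒≡ α β refl* =
    coord-injective (suc n) m (λ i → reflexive⁻ i (All.tabulate⁻ {f = colours α β} refl* i))

  isCC : CC.IsCC (countTup (suc n) m) expColour
  isCC = record
    { nonempty     = λ r → let ((α , β) , e) = Code.code-surjective r in α , β , e
    ; diagonal     = λ α β γ e → All-Reflexive⇒≡ β γ
        (All-resp-↭ (to (expColour-≡⇔ α α β γ) e)
                    (All.tabulate⁺ {f = colours α α} (λ i → reflexive⁺ i refl)))
    ; transpose    = λ α β γ δ e → from (expColour-≡⇔ β α δ γ)
        (subst₂ _↭_ (sym (profile-transpose α β)) (sym (profile-transpose γ δ))
                (map⁺ transposeColour (to (expColour-≡⇔ α β γ δ) e)))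
    ; intersection = λ r s α β α′ β′ e → trans (inum-expColour r s α β)
        (trans (sumProd-↭ (InClass-↭ r) (InClass-↭ s) (map⁺ weight (to (expColour-≡⇔ α β α′ β′) e)))
               (sym (inum-expColour r s α′ β′)))
    }
    where open Equivalence

  EdgeProfile : List Colour → Set
  EdgeProfile l = ∃₂ λ e ds → l ↭ e ∷ ds × EdgeColour e × All Reflexive ds

  EdgeProfile-resp-↭ : ∀ {l l′} → l ↭ l′ → EdgeProfile l → EdgeProfile l′
  EdgeProfile-resp-↭ l↭l′ (e , ds , l↭e∷ds , edge , refl*) =
    e , ds , ↭-trans (↭-sym l↭l′) l↭e∷ds , edge , refl*

  ProdEdge⇒EdgeProfile : ∀ α β → ProdEdge G α β → EdgeProfile (profile α β)
  ProdEdge⇒EdgeProfile α β (i , edge , rest) =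
    colours α β i , tabulate (removeAt (colours α β) i) , tabulate-removeAt (colours α β) i ,
    trans (adj-colourAt i _ _) edge ,
    All.tabulate⁺ (λ j → reflexive⁺ (punchIn i j) (rest (punchIn i j) (punchInᵢ≢i i j)))

  EdgeProfile⇒ProdEdge : ∀ α β → EdgeProfile (profile α β) → ProdEdge G α β
  EdgeProfile⇒ProdEdge α β (e , ds , p , edge , refl*)
    with i , refl , removed↭ds ← tabulate-↭-∷⁻ (colours α β) p =
    i , trans (sym (adj-colourAt i _ _)) edge , rest
    where
    refl-removed : ∀ j → Reflexive (colours α β (punchIn i j))
    refl-removed = All.tabulate⁻ (All-resp-↭ (↭-sym removed↭ds) refl*)
    rest : ∀ j → j ≢ i → coord {m = m} α j ≡ coord {m = m} β j
    rest j j≢i = reflexive⁻ j (subst (Reflexive ∘ colours α β) (punchIn-punchOut (j≢i ∘ sym))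
                                     (refl-removed (punchOut (j≢i ∘ sym))))

  ProdEdge-relation : CC.IsRelation (countTup (suc n) m) expColour (ProdEdge G)
  ProdEdge-relation α β γ δ e =
    EdgeProfile⇒ProdEdge γ δ ∘ EdgeProfile-resp-↭ (Equivalence.to (expColour-≡⇔ α β γ δ) e)
    ∘ ProdEdge⇒EdgeProfile α β

  SameExpClass⇒↭ : ∀ α β γ δ → SameExpClass c φ α β γ δ → profile γ δ ↭ profile α β
  SameExpClass⇒↭ α β γ δ (g , cγδ) = begin
    profile γ δ
      ≡⟨ tabulate-cong (λ i → trans (cong (φ i zero) (cγδ i)) (φcomp (g ⟨$⟩ˡ i) i zero _)) ⟩
    tabulate (colours α β ∘ (Perm.flip g ⟨$⟩ʳ_))
      ↭⟨ tabulate-permute (colours α β) (Perm.flip g) ⟩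
    profile α β ∎
    where open PermutationReasoning

  exp≥WL : ∀ {K} (cX : Ω → Ω → Fin K) → CC.IsWL (countTup (suc n) m) (ProdEdge G) cX → ExpGeq c φ cX
  exp≥WL cX cXWL α β γ δ same = CC.IsWL.smallest cXWL _ expColour isCC ProdEdge-relation α β γ δ
    (Equivalence.from (expColour-≡⇔ α β γ δ) (↭-sym (SameExpClass⇒↭ α β γ δ same)))

lemma5p2 : (n : ℕ) (m k : Fin n → ℕ)
    (G : (i : Fin n) → Graph (m i))
    (conn : (i : Fin n) → Connected (G i))
    (c : (i : Fin n) → Fin (m i) → Fin (m i) → Fin (k i))
    (cWL : (i : Fin n) → CC.IsWL (countFin (m i)) (Edge (G i)) (c i))
    (φ : (i j : Fin n) → Fin (k i) → Fin (k j))
    (φiso : (i j : Fin n) → IsAlgIso (c i) (c j) (φ i j))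
    (φE : (i j : Fin n) → MapsEdges (G i) (G j) (c i) (c j) (φ i j))
    (φid : (i : Fin n) (s : Fin (k i)) → φ i i s ≡ s)
    (φcomp : (i j l : Fin n) (s : Fin (k i)) → φ j l (φ i j s) ≡ φ i l s)
    (K : ℕ) (cX : Tup n m → Tup n m → Fin K)
    (cXWL : CC.IsWL (countTup n m) (ProdEdge G) cX) →
    ExpGeq c φ cX
lemma5p2 zero    m k G conn c cWL φ φiso φE φid φcomp K cX cXWL _ _ _ _ _ = refl
lemma5p2 (suc n) m k G conn c cWL φ φiso φE φid φcomp K cX cXWL =
  Exponentiation.exp≥WL G c (CC.IsWL.coherent ∘ cWL) φ φiso φE φid φcomp cX cXWL
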